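{- Let $m$ be a positive integer and $n=4m+\epsilon$ with $\epsilon\in\{ -1,0,1\}$. Then for any $P_I,P_J\in\overline{\mathcal{P}}_m$ there is $P_A\in\mathcal{P}_m$ such that $P_A\odot P_I$ and $P_A\odot P_J$ both belong to $\mathcal{P}_m$.
   Context: $\mathbb{F}$ is the two-element field, $V=\mathbb{F}^n$, $[n]=\{1,\dots,n\}$. For non-empty $I\subseteq[n]$, $P_I$ is the point of $\mathcal{P}(V)$ spanned by $\sum_{i\in I}e_i$; for distinct points $P,Q$, $P\odot Q$ is the third point on the projective line through them, so $P_I\odot P_J=P_{I\triangle J}$. $\mathcal{P}_m$ is the set of all $P_I$ with $|I|=2m$, and $\overline{\mathcal{P}}_m$ is the set of all points $P\odot P'$ with $P,P'$ distinct points of $\mathcal{P}_m$; for $n=4m+\epsilon$, $\epsilon\in\{ -1,0,1\}$, this is the set of all points $P_I$ with $|I|$ even. -}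

module Defs where

open import Data.Nat using (ℕ; _*_)
open import Data.Bool using (_xor_)
open import Data.Vec using (zipWith)
open import Data.Fin.Subset using (Subset; ∣_∣)
open import Data.Product using (∃₂; _×_)
open import Relation.Binary.PropositionalEquality using (_≡_)
open import Relation.Nullary using (¬_)

-- A subset I ⊆ [n] (nonempty) represents the point P_I of 𝒫(𝔽₂ⁿ)
-- spanned by Σ_{i∈I} e_i; distinct nonempty subsets give distinct points.

-- Symmetric difference I △ J, so that P_I ⊙ P_J = P_{I △ J}.
_△_ : ∀ {n} → Subset n → Subset n → Subset n
_△_ = zipWith _xor_

InP : ∀ {n} (m : ℕ) → Subset n → Set
InP m I = ∣ I ∣ ≡ 2 * m

-- P_I ∈ 𝒫̄_m  iff  P_I = P ⊙ P' for distinct P, P' ∈ 𝒫_m,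
-- i.e. I = A △ B for some A ≠ B with |A| = |B| = 2m.
InPbar : ∀ {n} (m : ℕ) → Subset n → Set
InPbar {n} m I = ∃₂ λ (A B : Subset n) → InP m A × InP m B × ¬ (A ≡ B) × (I ≡ A △ B)

-- Cut [n] into the regions I ∩ J, I ─ J, J ─ I and ∁ (I ∪ J), of sizes a, b, c, d, and write
-- ∣I∣ = 2p, ∣J∣ = 2q, where p, q ≤ 2m because I and J are sums of two points of 𝒫_m.
-- Since ∣A △ I∣ + 2∣A ∩ I∣ = ∣A∣ + ∣I∣, any A of size 2m with ∣A ∩ I∣ = p and ∣A ∩ J∣ = q
-- does the job (and differs from I and J, as the symmetric differences are nonempty).
-- Such an A is obtained by taking x, y, z, w points from the four regions with x + y = p,
-- x + z = q and x + y + z + w = 2m. These constraints confine x to an interval, which is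
-- nonempty because n is within one of 4m; the off-by-one is absorbed by the parity of
-- a + b and a + c.

module Submission where

open import Defs
open import Data.Nat using (ℕ; zero; suc; _+_; _*_; _∸_; _≤_; _<_; _⊓_; s≤s; z≤n)
open import Data.Nat.Properties
open import Data.Nat.Tactic.RingSolver using (solve-∀)
open import Data.Vec using ([]; _∷_)
open import Data.Fin.Subset using (Subset; ∣_∣; _∩_; _∪_; _─_; ∁; inside; outside)
open import Data.Fin.Subset.Properties using (∩-comm; ∣p∩q∣≤∣p∣)
open import Data.Product using (Σ; ∃-syntax; _×_; _,_; proj₁; proj₂; map)
open import Data.Sum using (_⊎_; inj₁; inj₂)
open import Function using (_∘_; id)
open import Relation.Binary.PropositionalEquality
open import Relation.Nullary using (¬_)

∣p△q∣+2∣p∩q∣≡∣p∣+∣q∣ : ∀ {n} (p q : Subset n) → ∣ p △ q ∣ + 2 * ∣ p ∩ q ∣ ≡ ∣ p ∣ + ∣ q ∣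
∣p△q∣+2∣p∩q∣≡∣p∣+∣q∣ []            []            = refl
∣p△q∣+2∣p∩q∣≡∣p∣+∣q∣ (inside  ∷ p) (inside  ∷ q) = begin
  ∣ p △ q ∣ + 2 * suc ∣ p ∩ q ∣          ≡⟨ +2*suc ∣ p △ q ∣ ∣ p ∩ q ∣ ⟩
  suc (suc (∣ p △ q ∣ + 2 * ∣ p ∩ q ∣))  ≡⟨ cong (suc ∘ suc) (∣p△q∣+2∣p∩q∣≡∣p∣+∣q∣ p q) ⟩
  suc (suc (∣ p ∣ + ∣ q ∣))              ≡⟨ cong suc (+-suc ∣ p ∣ ∣ q ∣) ⟨
  suc ∣ p ∣ + suc ∣ q ∣                  ∎
  where
  open ≡-Reasoning
  +2*suc : ∀ t k → t + 2 * suc k ≡ suc (suc (t + 2 * k))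
  +2*suc = solve-∀
∣p△q∣+2∣p∩q∣≡∣p∣+∣q∣ (inside  ∷ p) (outside ∷ q) = cong suc (∣p△q∣+2∣p∩q∣≡∣p∣+∣q∣ p q)
∣p△q∣+2∣p∩q∣≡∣p∣+∣q∣ (outside ∷ p) (inside  ∷ q) =
  trans (cong suc (∣p△q∣+2∣p∩q∣≡∣p∣+∣q∣ p q)) (sym (+-suc ∣ p ∣ ∣ q ∣))
∣p△q∣+2∣p∩q∣≡∣p∣+∣q∣ (outside ∷ p) (outside ∷ q) = ∣p△q∣+2∣p∩q∣≡∣p∣+∣q∣ p q

∣p△p∣≡0 : ∀ {n} (p : Subset n) → ∣ p △ p ∣ ≡ 0
∣p△p∣≡0 []            = refl
∣p△p∣≡0 (inside  ∷ p) = ∣p△p∣≡0 p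
∣p△p∣≡0 (outside ∷ p) = ∣p△p∣≡0 p

∣p△q∣≡1+r⇒p≢q : ∀ {n r} {p q : Subset n} → ∣ p △ q ∣ ≡ suc r → ¬ (p ≡ q)
∣p△q∣≡1+r⇒p≢q {p = p} ∣p△q∣≡1+r refl with () ← trans (sym (∣p△p∣≡0 p)) ∣p△q∣≡1+r

2∣p∩q∣≡∣q∣⇒∣p△q∣≡∣p∣ : ∀ {n} (p q : Subset n) → 2 * ∣ p ∩ q ∣ ≡ ∣ q ∣ → ∣ p △ q ∣ ≡ ∣ p ∣
2∣p∩q∣≡∣q∣⇒∣p△q∣≡∣p∣ p q e = +-cancelʳ-≡ (2 * ∣ p ∩ q ∣) ∣ p △ q ∣ ∣ p ∣
  (trans (∣p△q∣+2∣p∩q∣≡∣p∣+∣q∣ p q) (cong (∣ p ∣ +_) (sym e)))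

even-∣p△q∣ : ∀ {n M} (p q : Subset n) → ∣ p ∣ ≡ M → ∣ q ∣ ≡ M → ∃[ r ] ∣ p △ q ∣ ≡ 2 * r × r ≤ M
even-∣p△q∣ p q ∣p∣≡M ∣q∣≡M
  with r , refl ← m≤n⇒∃[o]m+o≡n (≤-trans (∣p∩q∣≤∣p∣ p q) (≤-reflexive ∣p∣≡M))
  = r , +-cancelʳ-≡ (2 * k) ∣ p △ q ∣ (2 * r) (begin
      ∣ p △ q ∣ + 2 * k   ≡⟨ ∣p△q∣+2∣p∩q∣≡∣p∣+∣q∣ p q ⟩
      ∣ p ∣ + ∣ q ∣       ≡⟨ cong₂ _+_ ∣p∣≡M ∣q∣≡M ⟩
      k + r + (k + r)     ≡⟨ rearrange k r ⟩
      2 * r + 2 * k       ∎)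
    , m≤n+m r k
  where
  open ≡-Reasoning
  k : ℕ
  k = ∣ p ∩ q ∣
  rearrange : ∀ k r → k + r + (k + r) ≡ 2 * r + 2 * k
  rearrange = solve-∀

∣p∩q∣+∣p─q∣≡∣p∣ : ∀ {n} (p q : Subset n) → ∣ p ∩ q ∣ + ∣ p ─ q ∣ ≡ ∣ p ∣
∣p∩q∣+∣p─q∣≡∣p∣ []            []            = refl
∣p∩q∣+∣p─q∣≡∣p∣ (inside  ∷ p) (inside  ∷ q) = cong suc (∣p∩q∣+∣p─q∣≡∣p∣ p q)
∣p∩q∣+∣p─q∣≡∣p∣ (inside  ∷ p) (outside ∷ q) =
  trans (+-suc ∣ p ∩ q ∣ ∣ p ─ q ∣) (cong suc (∣p∩q∣+∣p─q∣≡∣p∣ p q))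
∣p∩q∣+∣p─q∣≡∣p∣ (outside ∷ p) (inside  ∷ q) = ∣p∩q∣+∣p─q∣≡∣p∣ p q
∣p∩q∣+∣p─q∣≡∣p∣ (outside ∷ p) (outside ∷ q) = ∣p∩q∣+∣p─q∣≡∣p∣ p q

∣p∩q∣+∣q─p∣≡∣q∣ : ∀ {n} (p q : Subset n) → ∣ p ∩ q ∣ + ∣ q ─ p ∣ ≡ ∣ q ∣
∣p∩q∣+∣q─p∣≡∣q∣ p q = trans (cong (λ r → ∣ r ∣ + ∣ q ─ p ∣) (∩-comm p q)) (∣p∩q∣+∣p─q∣≡∣p∣ q p)

∣p∩q∣+∣p─q∣+∣q─p∣+∣∁[p∪q]∣≡n : ∀ {n} (p q : Subset n) →
  ∣ p ∩ q ∣ + ∣ p ─ q ∣ + ∣ q ─ p ∣ + ∣ ∁ (p ∪ q) ∣ ≡ n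
∣p∩q∣+∣p─q∣+∣q─p∣+∣∁[p∪q]∣≡n []            []            = refl
∣p∩q∣+∣p─q∣+∣q─p∣+∣∁[p∪q]∣≡n (inside  ∷ p) (inside  ∷ q) =
  cong suc (∣p∩q∣+∣p─q∣+∣q─p∣+∣∁[p∪q]∣≡n p q)
∣p∩q∣+∣p─q∣+∣q─p∣+∣∁[p∪q]∣≡n (inside  ∷ p) (outside ∷ q) =
  trans (cong (λ t → t + ∣ q ─ p ∣ + ∣ ∁ (p ∪ q) ∣) (+-suc ∣ p ∩ q ∣ ∣ p ─ q ∣))
        (cong suc (∣p∩q∣+∣p─q∣+∣q─p∣+∣∁[p∪q]∣≡n p q))
∣p∩q∣+∣p─q∣+∣q─p∣+∣∁[p∪q]∣≡n (outside ∷ p) (inside  ∷ q) =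
  trans (cong (_+ ∣ ∁ (p ∪ q) ∣) (+-suc (∣ p ∩ q ∣ + ∣ p ─ q ∣) ∣ q ─ p ∣))
        (cong suc (∣p∩q∣+∣p─q∣+∣q─p∣+∣∁[p∪q]∣≡n p q))
∣p∩q∣+∣p─q∣+∣q─p∣+∣∁[p∪q]∣≡n (outside ∷ p) (outside ∷ q) =
  trans (+-suc (∣ p ∩ q ∣ + ∣ p ─ q ∣ + ∣ q ─ p ∣) ∣ ∁ (p ∪ q) ∣)
        (cong suc (∣p∩q∣+∣p─q∣+∣q─p∣+∣∁[p∪q]∣≡n p q))

∃-subset-with-∃-region-sizes : ∀ {n} (p q : Subset n) {x y z w} →
  x ≤ ∣ p ∩ q ∣ → y ≤ ∣ p ─ q ∣ → z ≤ ∣ q ─ p ∣ → w ≤ ∣ ∁ (p ∪ q) ∣ →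
  ∃[ r ] ∣ r ∩ p ∣ ≡ x + y × ∣ r ∩ q ∣ ≡ x + z × ∣ r ∣ ≡ (x + y) + (z + w)
∃-subset-with-∃-region-sizes [] [] z≤n z≤n z≤n z≤n = [] , refl , refl , refl
∃-subset-with-∃-region-sizes (inside ∷ p) (inside ∷ q) {zero} _ y≤ z≤ w≤ =
  map (outside ∷_) id (∃-subset-with-∃-region-sizes p q z≤n y≤ z≤ w≤)
∃-subset-with-∃-region-sizes (inside ∷ p) (inside ∷ q) {suc x} (s≤s x≤) y≤ z≤ w≤
  with r , ∣r∩p∣≡ , ∣r∩q∣≡ , ∣r∣≡ ← ∃-subset-with-∃-region-sizes p q x≤ y≤ z≤ w≤
  = inside ∷ r , cong suc ∣r∩p∣≡ , cong suc ∣r∩q∣≡ , cong suc ∣r∣≡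
∃-subset-with-∃-region-sizes (inside ∷ p) (outside ∷ q) {y = zero} x≤ _ z≤ w≤ =
  map (outside ∷_) id (∃-subset-with-∃-region-sizes p q x≤ z≤n z≤ w≤)
∃-subset-with-∃-region-sizes (inside ∷ p) (outside ∷ q) {x} {suc y} {z} {w} x≤ (s≤s y≤) z≤ w≤
  with r , ∣r∩p∣≡ , ∣r∩q∣≡ , ∣r∣≡ ← ∃-subset-with-∃-region-sizes p q x≤ y≤ z≤ w≤
  = inside ∷ r , trans (cong suc ∣r∩p∣≡) (sym (+-suc x y)) , ∣r∩q∣≡
  , trans (cong suc ∣r∣≡) (cong (_+ (z + w)) (sym (+-suc x y)))
∃-subset-with-∃-region-sizes (outside ∷ p) (inside ∷ q) {z = zero} x≤ y≤ _ w≤ =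
  map (outside ∷_) id (∃-subset-with-∃-region-sizes p q x≤ y≤ z≤n w≤)
∃-subset-with-∃-region-sizes (outside ∷ p) (inside ∷ q) {x} {y} {suc z} {w} x≤ y≤ (s≤s z≤) w≤
  with r , ∣r∩p∣≡ , ∣r∩q∣≡ , ∣r∣≡ ← ∃-subset-with-∃-region-sizes p q x≤ y≤ z≤ w≤
  = inside ∷ r , ∣r∩p∣≡ , trans (cong suc ∣r∩q∣≡) (sym (+-suc x z))
  , trans (cong suc ∣r∣≡) (sym (+-suc (x + y) (z + w)))
∃-subset-with-∃-region-sizes (outside ∷ p) (outside ∷ q) {w = zero} x≤ y≤ z≤ _ =
  map (outside ∷_) id (∃-subset-with-∃-region-sizes p q x≤ y≤ z≤ z≤n)
∃-subset-with-∃-region-sizes (outside ∷ p) (outside ∷ q) {x} {y} {z} {suc w} x≤ y≤ z≤ (s≤s w≤)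
  with r , ∣r∩p∣≡ , ∣r∩q∣≡ , ∣r∣≡ ← ∃-subset-with-∃-region-sizes p q x≤ y≤ z≤ w≤
  = inside ∷ r , ∣r∩p∣≡ , ∣r∩q∣≡
  , trans (cong suc ∣r∣≡) (sym (trans (cong ((x + y) +_) (+-suc z w)) (+-suc (x + y) (z + w))))

2m≤1+2n⇒m≤n : ∀ {m n} → 2 * m ≤ suc (2 * n) → m ≤ n
2m≤1+2n⇒m≤n {m} {n} h = ≤-pred (*-cancelˡ-< 2 m (suc n) (subst (2 * m <_) (sym (*-suc 2 n)) (s≤s h)))

2m≤1+n⇒n≤2u+v⇒m≤u+v : ∀ {m n} u v → 2 * m ≤ suc n → n ≤ 2 * u + v → m ≤ u + v
2m≤1+n⇒n≤2u+v⇒m≤u+v {m} {n} u v lo n≤ = 2m≤1+2n⇒m≤n (≤-trans lo (s≤s (begin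
  n               ≤⟨ n≤ ⟩
  2 * u + v       ≤⟨ +-monoʳ-≤ (2 * u) (m≤n*m v 2) ⟩
  2 * u + 2 * v   ≡⟨ *-distribˡ-+ 2 u v ⟨
  2 * (u + v)     ∎)))
  where open ≤-Reasoning

≤+⊓ : ∀ {m} k {u v} → m ≤ k + u → m ≤ k + v → m ≤ k + (u ⊓ v)
≤+⊓ k {u} {v} m≤u m≤v = subst (_ ≤_) (sym (+-distribˡ-⊓ k u v)) (⊓-glb m≤u m≤v)

p≤b+[a⊓e]⊓[p⊓q] : ∀ {a b c d p q M e} → a + b ≡ 2 * p → a + c ≡ 2 * q →
  M ≤ q + (b + d) → M + e ≡ p + q + d → p ≤ b + ((a ⊓ e) ⊓ (p ⊓ q))
p≤b+[a⊓e]⊓[p⊓q] {a} {b} {c} {d} {p} {q} {M} {e} hp hq M≤ M+e≡ =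
  ≤+⊓ b (≤+⊓ b p≤b+a p≤b+e) (≤+⊓ b (m≤n+m p b) p≤b+q)
  where
  open ≤-Reasoning
  p≤b+a : p ≤ b + a
  p≤b+a = ≤-trans (m≤n*m p 2) (≤-reflexive (trans (sym hp) (+-comm a b)))
  p≤b+e : p ≤ b + e
  p≤b+e = +-cancelˡ-≤ M p (b + e) (begin
    M + p             ≤⟨ +-monoˡ-≤ p M≤ ⟩
    q + (b + d) + p   ≡⟨ rearrange₁ q b d p ⟩
    b + (p + q + d)   ≡⟨ cong (b +_) M+e≡ ⟨
    b + (M + e)       ≡⟨ rearrange₂ b M e ⟩
    M + (b + e)       ∎)
    where
    rearrange₁ : ∀ q b d p → q + (b + d) + p ≡ b + (p + q + d)
    rearrange₁ = solve-∀
    rearrange₂ : ∀ b M e → b + (M + e) ≡ M + (b + e)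
    rearrange₂ = solve-∀
  p≤b+q : p ≤ b + q
  p≤b+q = *-cancelˡ-≤ 2 (begin
    2 * p           ≡⟨ hp ⟨
    a + b           ≤⟨ +-monoˡ-≤ b (m≤m+n a c) ⟩
    a + c + b       ≡⟨ cong (_+ b) hq ⟩
    2 * q + b       ≤⟨ +-monoʳ-≤ (2 * q) (m≤n*m b 2) ⟩
    2 * q + 2 * b   ≡⟨ rearrange q b ⟩
    2 * (b + q)     ∎)
    where
    rearrange : ∀ q b → 2 * q + 2 * b ≡ 2 * (b + q)
    rearrange = solve-∀

solution-from-interval : ∀ {b c d p q M e x} → x ≤ e → x ≤ p → x ≤ q →
  p ≤ b + x → q ≤ c + x → p + q ≤ M + x → M + e ≡ p + q + d →
  ∃[ y ] ∃[ z ] ∃[ w ] (y ≤ b × z ≤ c × w ≤ d) × (x + y ≡ p × x + z ≡ q × (x + y) + (z + w) ≡ M)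
solution-from-interval {b} {c} {d} {M = M} {x = x} x≤e x≤p x≤q p≤ q≤ p+q≤ M+e≡
  with y , refl ← m≤n⇒∃[o]m+o≡n x≤p
     | z , refl ← m≤n⇒∃[o]m+o≡n x≤q
     | t , refl ← m≤n⇒∃[o]m+o≡n x≤e
  = y , z , w , (y≤b , z≤c , w≤d) , (refl , refl , trans (sym (+-assoc (x + y) z w)) x+y+z+w≡M)
  where
  x+y+z≤M : x + y + z ≤ M
  x+y+z≤M = +-cancelʳ-≤ x (x + y + z) M (subst (_≤ M + x) (shuffle x y z) p+q≤)
    where
    shuffle : ∀ x y z → x + y + (x + z) ≡ x + y + z + x
    shuffle = solve-∀
  w : ℕ
  w = proj₁ (m≤n⇒∃[o]m+o≡n x+y+z≤M)
  x+y+z+w≡M : x + y + z + w ≡ M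
  x+y+z+w≡M = proj₂ (m≤n⇒∃[o]m+o≡n x+y+z≤M)
  y≤b : y ≤ b
  y≤b = +-cancelˡ-≤ x y b (≤-trans p≤ (≤-reflexive (+-comm b x)))
  z≤c : z ≤ c
  z≤c = +-cancelˡ-≤ x z c (≤-trans q≤ (≤-reflexive (+-comm c x)))
  w+t≡d : w + t ≡ d
  w+t≡d = +-cancelˡ-≡ (x + y + z + x) (w + t) d
    (trans (lhs x y z w t) (trans (cong (_+ (x + t)) x+y+z+w≡M) (trans M+e≡ (rhs x y z d))))
    where
    lhs : ∀ x y z w t → x + y + z + x + (w + t) ≡ x + y + z + w + (x + t)
    lhs = solve-∀
    rhs : ∀ x y z d → x + y + (x + z) + d ≡ x + y + z + x + d
    rhs = solve-∀
  w≤d : w ≤ d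
  w≤d = ≤-trans (m≤m+n w t) (≤-reflexive w+t≡d)

∃-region-sizes : ∀ {a b c d p q M} → a + b ≡ 2 * p → a + c ≡ 2 * q → p ≤ M → q ≤ M →
  2 * M ≤ suc (a + b + c + d) → a + b + c + d ≤ suc (2 * M) →
  ∃[ x ] ∃[ y ] ∃[ z ] ∃[ w ] (x ≤ a × y ≤ b × z ≤ c × w ≤ d) × (x + y ≡ p × x + z ≡ q × (x + y) + (z + w) ≡ M)
∃-region-sizes {a} {b} {c} {d} {p} {q} {M} hp hq p≤M q≤M lo hi =
  let y , z , w , bounds , eqs = solution-from-interval x≤e x≤p x≤q p≤b+x q≤c+x p+q≤M+x M+e≡
  in  x , y , z , w , (x≤a , bounds) , eqs
  where
  open ≤-Reasoning
  n : ℕ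
  n = a + b + c + d
  n≡2p+[c+d] : n ≡ 2 * p + (c + d)
  n≡2p+[c+d] = trans (+-assoc (a + b) c d) (cong (_+ (c + d)) hp)
  n≡2q+[b+d] : n ≡ 2 * q + (b + d)
  n≡2q+[b+d] = trans (rearrange a b c d) (cong (_+ (b + d)) hq)
    where
    rearrange : ∀ a b c d → a + b + c + d ≡ a + c + (b + d)
    rearrange = solve-∀
  2[p+q]+d≡a+n : 2 * (p + q) + d ≡ a + n
  2[p+q]+d≡a+n = begin-equality
    2 * (p + q) + d       ≡⟨ cong (_+ d) (*-distribˡ-+ 2 p q) ⟩
    2 * p + 2 * q + d     ≡⟨ cong₂ (λ u v → u + v + d) hp hq ⟨
    a + b + (a + c) + d   ≡⟨ rearrange a b c d ⟩
    a + n                 ∎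
    where
    rearrange : ∀ a b c d → a + b + (a + c) + d ≡ a + (a + b + c + d)
    rearrange = solve-∀
  M≤[p+q]+d : M ≤ (p + q) + d
  M≤[p+q]+d = 2m≤1+n⇒n≤2u+v⇒m≤u+v (p + q) d lo
    (≤-trans (m≤n+m n a) (≤-reflexive (sym 2[p+q]+d≡a+n)))
  p+q≤a+M : p + q ≤ a + M
  p+q≤a+M = 2m≤1+2n⇒m≤n (begin
    2 * (p + q)           ≤⟨ m≤m+n (2 * (p + q)) d ⟩
    2 * (p + q) + d       ≡⟨ 2[p+q]+d≡a+n ⟩
    a + n                 ≤⟨ +-monoʳ-≤ a hi ⟩
    a + suc (2 * M)       ≡⟨ +-suc a (2 * M) ⟩
    suc (a + 2 * M)       ≤⟨ s≤s (+-monoˡ-≤ (2 * M) (m≤n*m a 2)) ⟩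
    suc (2 * a + 2 * M)   ≡⟨ cong suc (*-distribˡ-+ 2 a M) ⟨
    suc (2 * (a + M))     ∎)
  e : ℕ
  e = proj₁ (m≤n⇒∃[o]m+o≡n M≤[p+q]+d)
  M+e≡ : M + e ≡ p + q + d
  M+e≡ = proj₂ (m≤n⇒∃[o]m+o≡n M≤[p+q]+d)
  -- The largest x allowed by the upper bounds x ≤ a, p, q and x ≤ e (the latter says w ≤ d).
  x : ℕ
  x = (a ⊓ e) ⊓ (p ⊓ q)
  x≤a : x ≤ a
  x≤a = ≤-trans (m⊓n≤m _ _) (m⊓n≤m a e)
  x≤e : x ≤ e
  x≤e = ≤-trans (m⊓n≤m _ _) (m⊓n≤n a e)
  x≤p : x ≤ p
  x≤p = ≤-trans (m⊓n≤n _ _) (m⊓n≤m p q)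
  x≤q : x ≤ q
  x≤q = ≤-trans (m⊓n≤n _ _) (m⊓n≤n p q)
  p≤b+x : p ≤ b + x
  p≤b+x = p≤b+[a⊓e]⊓[p⊓q] {a} {b} {c} {d} {e = e} hp hq
    (2m≤1+n⇒n≤2u+v⇒m≤u+v q (b + d) lo (≤-reflexive n≡2q+[b+d])) M+e≡
  q≤c+x : q ≤ c + x
  q≤c+x = subst (λ u → q ≤ c + ((a ⊓ e) ⊓ u)) (⊓-comm q p)
    (p≤b+[a⊓e]⊓[p⊓q] {a} {c} {b} {d} {e = e} hq hp
      (2m≤1+n⇒n≤2u+v⇒m≤u+v p (c + d) lo (≤-reflexive n≡2p+[c+d])) (trans M+e≡ (cong (_+ d) (+-comm p q))))
  p+q≤M+x : p + q ≤ M + x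
  p+q≤M+x = ≤+⊓ M (≤+⊓ M (≤-trans p+q≤a+M (≤-reflexive (+-comm a M)))
                          (≤-trans (m≤m+n (p + q) d) (≤-reflexive (sym M+e≡))))
                   (≤+⊓ M (≤-trans (+-monoʳ-≤ p q≤M) (≤-reflexive (+-comm p M)))
                          (+-monoˡ-≤ q p≤M))

∃-subset-halving : ∀ {n M p q} (I J : Subset n) → ∣ I ∣ ≡ 2 * p → ∣ J ∣ ≡ 2 * q → p ≤ M → q ≤ M →
  2 * M ≤ suc n → n ≤ suc (2 * M) → ∃[ A ] ∣ A ∣ ≡ M × ∣ A ∩ I ∣ ≡ p × ∣ A ∩ J ∣ ≡ q
∃-subset-halving {n} {M} I J ∣I∣≡ ∣J∣≡ p≤M q≤M lo hi =
  let x , y , z , w , (x≤ , y≤ , z≤ , w≤) , (x+y≡p , x+z≡q , sum≡M) =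
        ∃-region-sizes (trans (∣p∩q∣+∣p─q∣≡∣p∣ I J) ∣I∣≡) (trans (∣p∩q∣+∣q─p∣≡∣q∣ I J) ∣J∣≡) p≤M q≤M
          (subst (λ t → 2 * M ≤ suc t) (sym total) lo) (subst (_≤ suc (2 * M)) (sym total) hi)
      A , ∣A∩I∣≡ , ∣A∩J∣≡ , ∣A∣≡ = ∃-subset-with-∃-region-sizes I J x≤ y≤ z≤ w≤
  in  A , trans ∣A∣≡ sum≡M , trans ∣A∩I∣≡ x+y≡p , trans ∣A∩J∣≡ x+z≡q
  where
  total : ∣ I ∩ J ∣ + ∣ I ─ J ∣ + ∣ J ─ I ∣ + ∣ ∁ (I ∪ J) ∣ ≡ n
  total = ∣p∩q∣+∣p─q∣+∣q─p∣+∣∁[p∪q]∣≡n I J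

InPbar⇒even : ∀ {n} m {I : Subset n} → InPbar m I → ∃[ p ] ∣ I ∣ ≡ 2 * p × p ≤ 2 * m
InPbar⇒even m (A , B , ∣A∣≡ , ∣B∣≡ , _ , refl) = even-∣p△q∣ A B ∣A∣≡ ∣B∣≡

within-one : ∀ {N n} → (n ≡ suc N ∸ 1 ⊎ (n ≡ suc N ⊎ n ≡ suc N + 1)) → suc N ≤ suc n × n ≤ suc (suc N)
within-one {N} (inj₁ refl)        = ≤-refl , ≤-trans (n≤1+n N) (n≤1+n (suc N))
within-one {N} (inj₂ (inj₁ refl)) = n≤1+n (suc N) , n≤1+n (suc N)
within-one {N} (inj₂ (inj₂ refl)) = ≤-trans (n≤1+n (suc N)) (s≤s (m≤m+n (suc N) 1)) , ≤-reflexive (+-comm (suc N) 1)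

lemma4p5 : (k : ℕ) → let m = suc k in (n : ℕ) → (n ≡ 4 * m ∸ 1 ⊎ (n ≡ 4 * m ⊎ n ≡ 4 * m + 1)) → (I J : Subset n) → InPbar m I → InPbar m J → Σ (Subset n) λ A → InP m A × ¬ (A ≡ I) × ¬ (A ≡ J) × InP m (A △ I) × InP m (A △ J)
lemma4p5 k n hn I J I∈P̄ J∈P̄ =
  let p , ∣I∣≡2p , p≤M = InPbar⇒even (suc k) I∈P̄
      q , ∣J∣≡2q , q≤M = InPbar⇒even (suc k) J∈P̄
      4m≤1+n , n≤1+4m = within-one hn
      A , ∣A∣≡M , ∣A∩I∣≡p , ∣A∩J∣≡q = ∃-subset-halving I J ∣I∣≡2p ∣J∣≡2q p≤M q≤M
        (subst (_≤ suc n) 4m≡2M 4m≤1+n) (subst (λ t → n ≤ suc t) 4m≡2M n≤1+4m)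
      ∣A△I∣≡M = trans (2∣p∩q∣≡∣q∣⇒∣p△q∣≡∣p∣ A I (trans (cong (2 *_) ∣A∩I∣≡p) (sym ∣I∣≡2p))) ∣A∣≡M
      ∣A△J∣≡M = trans (2∣p∩q∣≡∣q∣⇒∣p△q∣≡∣p∣ A J (trans (cong (2 *_) ∣A∩J∣≡q) (sym ∣J∣≡2q))) ∣A∣≡M
  in  A , ∣A∣≡M , ∣p△q∣≡1+r⇒p≢q ∣A△I∣≡M , ∣p△q∣≡1+r⇒p≢q ∣A△J∣≡M , ∣A△I∣≡M , ∣A△J∣≡M
  where
  4m≡2M : 4 * suc k ≡ 2 * (2 * suc k)
  4m≡2M = *-assoc 2 2 (suc k)
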